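{- Let $B$ be a directed bipartite graph with vertex parts $L$ and $R$ in which every edge is oriented from $L$ to $R$, and let $\mathcal{D}(B)$ be the directed multi-graph constructed from $B$ as described in the context, with source $s$ and sink $t$. For $u\in L$ and $v\in R$: upon failure (deletion) of one copy of edge $(s,u)$ and one copy of edge $(v,t)$ in $\mathcal{D}(B)$, the capacity of an $(s,t)$-mincut in $\mathcal{D}(B)$ reduces by exactly $1$ if and only if the edge $(u,v)$ is present in $B$.
   Context: Construction of $\mathcal{D}(B)$: the vertex set is $L\cup R\cup\{s,t\}$ (with $s,t$ new vertices); include every edge of $B$ (oriented $L\to R$); for each $u\in L$ with $p>0$ outgoing edges in $B$ add $p$ edges from $s$ to $u$; for each $u\in R$ with $p>0$ incoming edges in $B$ add $p$ edges from $u$ to $t$; additionally for each $u\in L\cup R$ add one edge from $s$ to $u$ and one edge from $u$ to $t$. (In the paper $\mathcal{D}(B)$ arises from a graph with an extra set of isolated Steiner vertices, one of which becomes $t$ and the rest of which are contracted into $s$.) An $(s,t)$-cut is a set $C$ with $s\in C$, $t\notin C$; its capacity is the number of edges leaving $C$ (from $C$ to its complement); an $(s,t)$-mincut is an $(s,t)$-cut of minimum capacity. -}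

module Defs where

open import Data.Nat using (ℕ; zero; suc; _+_; _∸_; _≤_)
open import Data.Bool using (Bool; true; false; if_then_else_)
open import Data.Fin using (Fin)
open import Data.Fin.Properties using (_≟_)
open import Data.List using (List; _∷_; []; map; _++_; allFin; concatMap)
open import Data.Nat.ListAction using (sum)
open import Data.Product using (Σ; _×_; _,_)
open import Relation.Binary.PropositionalEquality using (_≡_)
open import Relation.Nullary using (yes; no)

-- A directed bipartite graph B with parts L = Fin m and R = Fin n,
-- every edge oriented L → R; B u v ≡ true iff the edge (u,v) is present.
BipGraph : ℕ → ℕ → Set
BipGraph m n = Fin m → Fin n → Bool

data Vtx (m n : ℕ) : Set where
  src : Vtx m n
  snk : Vtx m n
  inL : Fin m → Vtx m n
  inR : Fin n → Vtx m n

allVtx : (m n : ℕ) → List (Vtx m n)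
allVtx m n = src ∷ snk ∷ (map inL (allFin m) ++ map inR (allFin n))

MultiGraph : ℕ → ℕ → Set
MultiGraph m n = Vtx m n → Vtx m n → ℕ

b2n : Bool → ℕ
b2n true = 1
b2n false = 0

outdeg : ∀ {m n} → BipGraph m n → Fin m → ℕ
outdeg {m} {n} B u = sum (map (λ v → b2n (B u v)) (allFin n))

indeg : ∀ {m n} → BipGraph m n → Fin n → ℕ
indeg {m} {n} B v = sum (map (λ u → b2n (B u v)) (allFin m))

𝒟 : ∀ {m n} → BipGraph m n → MultiGraph m n
𝒟 B (inL u) (inR v) = b2n (B u v)
𝒟 B src (inL u) = outdeg B u + 1
𝒟 B src (inR v) = 1
𝒟 B (inL u) snk = 1
𝒟 B (inR v) snk = indeg B v + 1
𝒟 B _ _ = 0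

failSU-VT : ∀ {m n} → MultiGraph m n → Fin m → Fin n → MultiGraph m n
failSU-VT G u v src (inL u') with u ≟ u'
... | yes _ = G src (inL u') ∸ 1
... | no _ = G src (inL u')
failSU-VT G u v (inR v') snk with v ≟ v'
... | yes _ = G (inR v') snk ∸ 1
... | no _ = G (inR v') snk
failSU-VT G u v x y = G x y

IsSTCut : ∀ {m n} → (Vtx m n → Bool) → Set
IsSTCut C = (C src ≡ true) × (C snk ≡ false)

capacity : ∀ {m n} → MultiGraph m n → (Vtx m n → Bool) → ℕ
capacity {m} {n} G C =
  sum (concatMap (λ x → map (λ y → if C x then (if C y then 0 else G x y) else 0)
                            (allVtx m n))
                 (allVtx m n))

IsMinCutCapacity : ∀ {m n} → MultiGraph m n → ℕ → Set
IsMinCutCapacity G k =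
  Σ _ (λ C → IsSTCut C × capacity G C ≡ k)
  × (∀ C → IsSTCut C → k ≤ capacity G C)

{-# OPTIONS --safe #-}
module Submission where

open import Defs
open import Data.Nat using (ℕ; zero; suc; _+_; _≤_; _<_; z≤n; s≤s)
open import Data.Nat.Properties
  using (+-identityʳ; +-suc; +-comm; +-assoc; m≤m+n; m≤n+m; ≤-trans; ≤-reflexive; ≤-antisym;
         +-monoʳ-≤; +-monoˡ-≤; +-cancelʳ-≤; <-irrefl; m∸n+n≡m;
         +-0-commutativeMonoid; +-commutativeSemigroup)
open import Algebra.Properties.CommutativeMonoid.Sum +-0-commutativeMonoid
  using (sum-syntax; ∑-distrib-+; ∑-comm; sum-cong-≗; sum-replicate-zero; sum-remove)
open import Algebra.Properties.CommutativeSemigroup +-commutativeSemigroup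
  using (interchange; x∙yz≈xz∙y; xy∙z≈xz∙y)
open import Data.Bool using (Bool; true; false; if_then_else_; not)
open import Data.Bool.Properties using (if-eta; if-cong; if-cong-then; if-swap-then)
open import Data.Fin using (Fin; zero; suc)
open import Data.Fin.Properties using (_≟_)
open import Data.List as List using (List; _∷_; []; map; _++_; allFin; concatMap)
open import Data.List.Properties using (map-tabulate; map-cong; map-++; map-∘)
open import Data.Nat.ListAction using (sum)
open import Data.Nat.ListAction.Properties using (sum-++)
open import Data.Product using (_,_)
open import Data.Empty using (⊥-elim)
open import Function using (_∘_; id)
open import Function.Bundles using (_⇔_; mk⇔)
open import Relation.Nullary.Decidable using (yes; no; does; dec-true)
open import Relation.Binary.PropositionalEquality
open ≡-Reasoning

-- In an (s,t)-cut C of 𝒟(B) every vertex of L ∪ R contributes one unit (its extra edge from s or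
-- to t crosses C), and every edge (i,j) of B is paid for by a crossing copy of (s,i) if i ∉ C, by
-- (i,j) itself if i ∈ C ∌ j, and by a copy of (j,t) if j ∈ C: once in total, twice when i ∉ C ∋ j.
-- So cap C = |L| + |R| + |E(B)| + #{back edges i ∉ C ∋ j}, minimised by C = {s}.
-- Deleting a copy of (s,u) and of (v,t) lowers cap C by [u ∉ C] + [v ∈ C], which is 2 only when
-- u ∉ C ∋ v, and then (u,v) ∈ B is a back edge costing one unit. Hence the minimum drops by exactly
-- 1 if (u,v) ∈ B, while otherwise the cut {s} ∪ (L ∖ {u}) ∪ {v} makes it drop by at least 2.

sum-tabulate : ∀ {n} (f : Fin n → ℕ) → sum (List.tabulate f) ≡ ∑[ i < n ] f i
sum-tabulate {zero}  f = refl
sum-tabulate {suc n} f = cong (f zero +_) (sum-tabulate (f ∘ suc))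

sum-map-allFin : ∀ {n} (f : Fin n → ℕ) → sum (map f (allFin n)) ≡ ∑[ i < n ] f i
sum-map-allFin f = trans (cong sum (map-tabulate id f)) (sum-tabulate f)

sum-map-+ : ∀ {A : Set} (f g : A → ℕ) xs →
            sum (map (λ x → f x + g x) xs) ≡ sum (map f xs) + sum (map g xs)
sum-map-+ f g []       = refl
sum-map-+ f g (x ∷ xs) =
  trans (cong (f x + g x +_) (sum-map-+ f g xs)) (interchange (f x) (g x) _ _)

sum-concatMap : ∀ {A : Set} (f : A → List ℕ) xs → sum (concatMap f xs) ≡ sum (map (sum ∘ f) xs)
sum-concatMap f []       = refl
sum-concatMap f (x ∷ xs) = trans (sum-++ (f x) _) (cong (sum (f x) +_) (sum-concatMap f xs))

∑-one : ∀ n → ∑[ i < n ] 1 ≡ n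
∑-one zero    = refl
∑-one (suc n) = cong suc (∑-one n)

∑-if-0 : ∀ {n} (c : Fin n → Bool) → ∑[ i < n ] (if c i then 0 else 0) ≡ 0
∑-if-0 {n} c = trans (sum-cong-≗ (λ i → if-eta (c i))) (sum-replicate-zero n)

∑-δ : ∀ {n} (j : Fin n) (f : Fin n → ℕ) → ∑[ i < n ] (if does (j ≟ i) then f i else 0) ≡ f j
∑-δ {suc n} zero    f = trans (cong (f zero +_) (sum-replicate-zero n)) (+-identityʳ (f zero))
∑-δ         (suc j) f = ∑-δ j (f ∘ suc)

∑∑-distrib-+ : ∀ {m n} (f g : Fin m → Fin n → ℕ) →
               ∑[ i < m ] ∑[ j < n ] (f i j + g i j)
               ≡ ∑[ i < m ] ∑[ j < n ] f i j + ∑[ i < m ] ∑[ j < n ] g i j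
∑∑-distrib-+ {n = n} f g =
  trans (sum-cong-≗ (λ i → ∑-distrib-+ (f i) (g i))) (∑-distrib-+ (λ i → ∑[ j < n ] f i j) _)

term≤∑ : ∀ {n} (f : Fin n → ℕ) i → f i ≤ ∑[ j < n ] f j
term≤∑ {suc n} f i = ≤-trans (m≤m+n (f i) _) (≤-reflexive (sym (sum-remove f)))

sum-allVtx : ∀ {m n} (h : Vtx m n → ℕ) →
             sum (map h (allVtx m n)) ≡ h src + (h snk + (∑[ i < m ] h (inL i) + ∑[ j < n ] h (inR j)))
sum-allVtx {m} {n} h = cong (λ parts → h src + (h snk + parts)) (begin
  sum (map h (map inL (allFin m) ++ map inR (allFin n)))
    ≡⟨ cong sum (map-++ h (map inL (allFin m)) _) ⟩
  sum (map h (map inL (allFin m)) ++ map h (map inR (allFin n)))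
    ≡⟨ sum-++ (map h (map inL (allFin m))) _ ⟩
  sum (map h (map inL (allFin m))) + sum (map h (map inR (allFin n)))
    ≡⟨ cong₂ _+_ (sum-map-inj inL) (sum-map-inj inR) ⟩
  ∑[ i < m ] h (inL i) + ∑[ j < n ] h (inR j) ∎)
  where
  sum-map-inj : ∀ {k} (ι : Fin k → Vtx m n) → sum (map h (map ι (allFin k))) ≡ ∑[ i < k ] h (ι i)
  sum-map-inj {k} ι = trans (cong sum (sym (map-∘ {g = h} {f = ι} (allFin k)))) (sum-map-allFin (h ∘ ι))

crossing : ∀ {m n} → MultiGraph m n → (Vtx m n → Bool) → Vtx m n → Vtx m n → ℕ
crossing G C x y = if C x then (if C y then 0 else G x y) else 0

capacity-as-double-sum : ∀ {m n} (G : MultiGraph m n) C →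
                         capacity G C ≡ sum (map (λ x → sum (map (crossing G C x) (allVtx m n))) (allVtx m n))
capacity-as-double-sum {m} {n} G C = sum-concatMap (λ x → map (crossing G C x) (allVtx m n)) (allVtx m n)

capacity-+ : ∀ {m n} (G H K : MultiGraph m n) (C : Vtx m n → Bool) →
             (∀ x y → G x y ≡ H x y + K x y) → capacity G C ≡ capacity H C + capacity K C
capacity-+ {m} {n} G H K C G≡H+K = begin
  capacity G C
    ≡⟨ capacity-as-double-sum G C ⟩
  sum (map (λ x → ∑V (crossing G C x)) V)
    ≡⟨ cong sum (map-cong row-+ V) ⟩
  sum (map (λ x → ∑V (crossing H C x) + ∑V (crossing K C x)) V)
    ≡⟨ sum-map-+ (λ x → ∑V (crossing H C x)) (λ x → ∑V (crossing K C x)) V ⟩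
  sum (map (λ x → ∑V (crossing H C x)) V) + sum (map (λ x → ∑V (crossing K C x)) V)
    ≡⟨ cong₂ _+_ (capacity-as-double-sum H C) (capacity-as-double-sum K C) ⟨
  capacity H C + capacity K C ∎
  where
  V = allVtx m n
  ∑V : (Vtx m n → ℕ) → ℕ
  ∑V h = sum (map h V)
  crossing-+ : ∀ x y → crossing G C x y ≡ crossing H C x y + crossing K C x y
  crossing-+ x y with C x | C y
  ... | true  | true  = refl
  ... | true  | false = G≡H+K x y
  ... | false | _     = refl
  row-+ : ∀ x → ∑V (crossing G C x) ≡ ∑V (crossing H C x) + ∑V (crossing K C x)
  row-+ x = trans (cong sum (map-cong (crossing-+ x) V)) (sum-map-+ (crossing H C x) (crossing K C x) V)

outflow : ∀ {m n} → MultiGraph m n → (Vtx m n → Bool) → Vtx m n → ℕ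
outflow {m} {n} G C x =
  G x snk + (∑[ i < m ] (if C (inL i) then 0 else G x (inL i))
           + ∑[ j < n ] (if C (inR j) then 0 else G x (inR j)))

capacity-cut : ∀ {m n} (G : MultiGraph m n) C → IsSTCut C →
               capacity G C ≡ outflow G C src + (∑[ i < m ] (if C (inL i) then outflow G C (inL i) else 0)
                                              + ∑[ j < n ] (if C (inR j) then outflow G C (inR j) else 0))
capacity-cut {m} {n} G C (s∈C , t∉C) = begin
  capacity G C
    ≡⟨ capacity-as-double-sum G C ⟩
  sum (map (λ x → sum (map (crossing G C x) (allVtx m n))) (allVtx m n))
    ≡⟨ cong sum (map-cong row (allVtx m n)) ⟩
  sum (map (λ x → if C x then outflow G C x else 0) (allVtx m n))
    ≡⟨ sum-allVtx (λ x → if C x then outflow G C x else 0) ⟩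
  (if C src then outflow G C src else 0) + ((if C snk then outflow G C snk else 0) + ∑LR)
    ≡⟨ cong₂ (λ a b → a + (b + ∑LR)) (if-cong s∈C) (if-cong t∉C) ⟩
  outflow G C src + ∑LR ∎
  where
  ∑LR = ∑[ i < m ] (if C (inL i) then outflow G C (inL i) else 0)
      + ∑[ j < n ] (if C (inR j) then outflow G C (inR j) else 0)
  row : ∀ x → sum (map (crossing G C x) (allVtx m n)) ≡ (if C x then outflow G C x else 0)
  row x with C x
  ... | true  = trans (sum-allVtx (λ y → if C y then 0 else G x y))
                      (cong₂ (λ a b → a + (b + outflowLR)) (if-cong s∈C) (if-cong t∉C))
    where outflowLR = ∑[ i < m ] (if C (inL i) then 0 else G x (inL i))
                    + ∑[ j < n ] (if C (inR j) then 0 else G x (inR j))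
  ... | false = trans (sum-allVtx {m} {n} (λ _ → 0)) (cong₂ _+_ (sum-replicate-zero m) (sum-replicate-zero n))

failedEdges : ∀ {m n} → Fin m → Fin n → MultiGraph m n
failedEdges u v src     (inL i) = if does (u ≟ i) then 1 else 0
failedEdges u v (inR j) snk     = if does (v ≟ j) then 1 else 0
failedEdges u v _       _       = 0

failSU-VT+failedEdges : ∀ {m n} (G : MultiGraph m n) u v → 1 ≤ G src (inL u) → 1 ≤ G (inR v) snk →
                        ∀ x y → G x y ≡ failSU-VT G u v x y + failedEdges u v x y
failSU-VT+failedEdges G u v 1≤su _ src (inL i) with u ≟ i
... | yes refl = sym (m∸n+n≡m 1≤su)
... | no  _    = sym (+-identityʳ _)
failSU-VT+failedEdges G u v _ 1≤vt (inR j) snk with v ≟ j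
... | yes refl = sym (m∸n+n≡m 1≤vt)
... | no  _    = sym (+-identityʳ _)
failSU-VT+failedEdges G u v _ _ src     src     = sym (+-identityʳ _)
failSU-VT+failedEdges G u v _ _ src     snk     = sym (+-identityʳ _)
failSU-VT+failedEdges G u v _ _ src     (inR _) = sym (+-identityʳ _)
failSU-VT+failedEdges G u v _ _ (inR _) src     = sym (+-identityʳ _)
failSU-VT+failedEdges G u v _ _ (inR _) (inL _) = sym (+-identityʳ _)
failSU-VT+failedEdges G u v _ _ (inR _) (inR _) = sym (+-identityʳ _)
failSU-VT+failedEdges G u v _ _ snk     _       = sym (+-identityʳ _)
failSU-VT+failedEdges G u v _ _ (inL _) _       = sym (+-identityʳ _)

capacity-failedEdges : ∀ {m n} (u : Fin m) (v : Fin n) C → IsSTCut C →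
  capacity (failedEdges u v) C ≡ (if C (inL u) then 0 else 1) + (if C (inR v) then 1 else 0)
capacity-failedEdges {m} {n} u v C cut = begin
  capacity Δ C
    ≡⟨ capacity-cut Δ C cut ⟩
  outflow Δ C src + (∑[ i < m ] (if C (inL i) then outflow Δ C (inL i) else 0)
                   + ∑[ j < n ] (if C (inR j) then outflow Δ C (inR j) else 0))
    ≡⟨ cong₂ _+_ outflow-src (cong₂ _+_ outflows-L outflows-R) ⟩
  (if C (inL u) then 0 else 1) + (0 + (if C (inR v) then 1 else 0)) ∎
  where
  Δ = failedEdges u v

  δ-outside-cut : ∀ b c → (if b then 0 else (if c then 1 else 0)) ≡ (if c then (if b then 0 else 1) else 0)
  δ-outside-cut true  c = sym (if-eta c)
  δ-outside-cut false c = refl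

  outflow-src : outflow Δ C src ≡ (if C (inL u) then 0 else 1)
  outflow-src = begin
    ∑[ i < m ] (if C (inL i) then 0 else (if does (u ≟ i) then 1 else 0))
      + ∑[ j < n ] (if C (inR j) then 0 else 0)
      ≡⟨ cong₂ _+_ (sum-cong-≗ (λ i → δ-outside-cut (C (inL i)) (does (u ≟ i))))
                   (∑-if-0 (C ∘ inR)) ⟩
    ∑[ i < m ] (if does (u ≟ i) then (if C (inL i) then 0 else 1) else 0) + 0
      ≡⟨ +-identityʳ _ ⟩
    ∑[ i < m ] (if does (u ≟ i) then (if C (inL i) then 0 else 1) else 0)
      ≡⟨ ∑-δ u (λ i → if C (inL i) then 0 else 1) ⟩
    (if C (inL u) then 0 else 1) ∎

  inner-zero : ∑[ i < m ] (if C (inL i) then 0 else 0) + ∑[ j < n ] (if C (inR j) then 0 else 0) ≡ 0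
  inner-zero = cong₂ _+_ (∑-if-0 (C ∘ inL)) (∑-if-0 (C ∘ inR))

  outflows-L : ∑[ i < m ] (if C (inL i) then outflow Δ C (inL i) else 0) ≡ 0
  outflows-L = trans (sum-cong-≗ (λ i → trans (if-cong-then (C (inL i)) inner-zero) (if-eta (C (inL i)))))
                     (sum-replicate-zero m)

  outflow-inR : ∀ j → outflow Δ C (inR j) ≡ (if does (v ≟ j) then 1 else 0)
  outflow-inR j = trans (cong ((if does (v ≟ j) then 1 else 0) +_) inner-zero) (+-identityʳ _)

  outflows-R : ∑[ j < n ] (if C (inR j) then outflow Δ C (inR j) else 0) ≡ (if C (inR v) then 1 else 0)
  outflows-R = begin
    ∑[ j < n ] (if C (inR j) then outflow Δ C (inR j) else 0)
      ≡⟨ sum-cong-≗ (λ j → if-cong-then (C (inR j)) (outflow-inR j)) ⟩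
    ∑[ j < n ] (if C (inR j) then (if does (v ≟ j) then 1 else 0) else 0)
      ≡⟨ sum-cong-≗ (λ j → if-swap-then (C (inR j)) (does (v ≟ j))) ⟩
    ∑[ j < n ] (if does (v ≟ j) then (if C (inR j) then 1 else 0) else 0)
      ≡⟨ ∑-δ v (λ j → if C (inR j) then 1 else 0) ⟩
    (if C (inR v) then 1 else 0) ∎

sourceCut : ∀ {m n} → Vtx m n → Bool
sourceCut src = true
sourceCut _   = false

uvCut : ∀ {m n} → Fin m → Fin n → Vtx m n → Bool
uvCut u v src     = true
uvCut u v snk     = false
uvCut u v (inL i) = not (does (u ≟ i))
uvCut u v (inR j) = does (v ≟ j)

minCut-unique : ∀ {m n} {G : MultiGraph m n} {k k′} →
                IsMinCutCapacity G k → IsMinCutCapacity G k′ → k ≡ k′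
minCut-unique ((C , cut , C≡k) , k-min) ((C′ , cut′ , C′≡k′) , k′-min) =
  ≤-antisym (≤-trans (k-min C′ cut′) (≤-reflexive C′≡k′)) (≤-trans (k′-min C cut) (≤-reflexive C≡k))

module _ {m n} (B : BipGraph m n) where

  edgeCount : ℕ
  edgeCount = ∑[ i < m ] ∑[ j < n ] b2n (B i j)

  outdeg-∑ : ∀ i → outdeg B i ≡ ∑[ j < n ] b2n (B i j)
  outdeg-∑ i = sum-map-allFin (λ j → b2n (B i j))

  indeg-∑ : ∀ j → indeg B j ≡ ∑[ i < m ] b2n (B i j)
  indeg-∑ j = sum-map-allFin (λ i → b2n (B i j))

  backTerm : (Vtx m n → Bool) → Fin m → Fin n → ℕ
  backTerm C i j = if C (inL i) then 0 else (if C (inR j) then b2n (B i j) else 0)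

  backEdges : (Vtx m n → Bool) → ℕ
  backEdges C = ∑[ i < m ] ∑[ j < n ] backTerm C i j

  backEdge≤backEdges : ∀ C i j → C (inL i) ≡ false → C (inR j) ≡ true → b2n (B i j) ≤ backEdges C
  backEdge≤backEdges C i j i∉C j∈C =
    ≤-trans (≤-reflexive term≡b)
            (≤-trans (term≤∑ (backTerm C i) j) (term≤∑ (λ i′ → ∑[ j′ < n ] backTerm C i′ j′) i))
    where
    term≡b : b2n (B i j) ≡ backTerm C i j
    term≡b rewrite i∉C | j∈C = refl

  module _ (C : Vtx m n → Bool) where

    chargedToTail chargedToHead : Fin m → Fin n → ℕ
    chargedToTail i j = if C (inL i) then (if C (inR j) then 0 else b2n (B i j)) else b2n (B i j)
    chargedToHead i j = if C (inR j) then b2n (B i j) else 0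

    capacity-𝒟-by-vertex : IsSTCut C →
      capacity (𝒟 B) C ≡ ∑[ i < m ] (1 + ∑[ j < n ] chargedToTail i j)
                       + ∑[ j < n ] (1 + ∑[ i < m ] chargedToHead i j)
    capacity-𝒟-by-vertex cut = begin
      capacity (𝒟 B) C
        ≡⟨ capacity-cut (𝒟 B) C cut ⟩
      outflow (𝒟 B) C src + (∑[ i < m ] (if C (inL i) then outflow (𝒟 B) C (inL i) else 0)
                           + ∑[ j < n ] (if C (inR j) then outflow (𝒟 B) C (inR j) else 0))
        ≡⟨ cong (outflow (𝒟 B) C src +_) (cong₂ _+_
             (sum-cong-≗ (λ i → if-cong-then (C (inL i)) (outflow-inL i)))
             (sum-cong-≗ (λ j → if-cong-then (C (inR j)) (outflow-inR j)))) ⟩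
      (∑[ i < m ] sourceL i + ∑[ j < n ] sourceR j) + (∑[ i < m ] sinkL i + ∑[ j < n ] sinkR j)
        ≡⟨ interchange (∑[ i < m ] sourceL i) _ _ _ ⟩
      (∑[ i < m ] sourceL i + ∑[ i < m ] sinkL i) + (∑[ j < n ] sourceR j + ∑[ j < n ] sinkR j)
        ≡⟨ cong₂ _+_ (∑-distrib-+ sourceL sinkL) (∑-distrib-+ sourceR sinkR) ⟨
      ∑[ i < m ] (sourceL i + sinkL i) + ∑[ j < n ] (sourceR j + sinkR j)
        ≡⟨ cong₂ _+_ (sum-cong-≗ charge-inL) (sum-cong-≗ charge-inR) ⟩
      ∑[ i < m ] (1 + ∑[ j < n ] chargedToTail i j) + ∑[ j < n ] (1 + ∑[ i < m ] chargedToHead i j) ∎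
      where
      sourceL sinkL : Fin m → ℕ
      sourceL i = if C (inL i) then 0 else outdeg B i + 1
      sinkL   i = if C (inL i) then 1 + ∑[ j < n ] (if C (inR j) then 0 else b2n (B i j)) else 0
      sourceR sinkR : Fin n → ℕ
      sourceR j = if C (inR j) then 0 else 1
      sinkR   j = if C (inR j) then indeg B j + 1 else 0

      outflow-inL : ∀ i → outflow (𝒟 B) C (inL i) ≡ 1 + ∑[ j < n ] (if C (inR j) then 0 else b2n (B i j))
      outflow-inL i = cong (λ z → 1 + (z + ∑[ j < n ] (if C (inR j) then 0 else b2n (B i j))))
                           (∑-if-0 (C ∘ inL))

      outflow-inR : ∀ j → outflow (𝒟 B) C (inR j) ≡ indeg B j + 1
      outflow-inR j = trans (cong (indeg B j + 1 +_) (cong₂ _+_ (∑-if-0 (C ∘ inL)) (∑-if-0 (C ∘ inR))))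
                            (+-identityʳ _)

      charge-inL : ∀ i → sourceL i + sinkL i ≡ 1 + ∑[ j < n ] chargedToTail i j
      charge-inL i with C (inL i)
      ... | true  = refl
      ... | false = trans (+-identityʳ _) (trans (+-comm (outdeg B i) 1) (cong suc (outdeg-∑ i)))

      charge-inR : ∀ j → sourceR j + sinkR j ≡ 1 + ∑[ i < m ] chargedToHead i j
      charge-inR j with C (inR j)
      ... | true  = trans (+-comm (indeg B j) 1) (cong suc (indeg-∑ j))
      ... | false = cong suc (sym (sum-replicate-zero m))

    charge-split : ∀ i j → chargedToTail i j + chargedToHead i j ≡ b2n (B i j) + backTerm C i j
    charge-split i j with C (inL i) | C (inR j)
    ... | true  | true  = sym (+-identityʳ _)
    ... | true  | false = refl
    ... | false | true  = refl
    ... | false | false = refl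

  capacity-𝒟 : ∀ C → IsSTCut C → capacity (𝒟 B) C ≡ m + n + edgeCount + backEdges C
  capacity-𝒟 C cut = begin
    capacity (𝒟 B) C
      ≡⟨ capacity-𝒟-by-vertex C cut ⟩
    ∑[ i < m ] (1 + ∑[ j < n ] tail i j) + ∑[ j < n ] (1 + ∑[ i < m ] head i j)
      ≡⟨ cong₂ _+_ (∑-distrib-+ (λ _ → 1) (λ i → ∑[ j < n ] tail i j))
                   (∑-distrib-+ (λ _ → 1) (λ j → ∑[ i < m ] head i j)) ⟩
    (∑[ i < m ] 1 + ∑[ i < m ] ∑[ j < n ] tail i j) + (∑[ j < n ] 1 + ∑[ j < n ] ∑[ i < m ] head i j)
      ≡⟨ cong₂ _+_ (cong (_+ ∑[ i < m ] ∑[ j < n ] tail i j) (∑-one m))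
                   (cong₂ _+_ (∑-one n) (sym (∑-comm head))) ⟩
    (m + ∑[ i < m ] ∑[ j < n ] tail i j) + (n + ∑[ i < m ] ∑[ j < n ] head i j)
      ≡⟨ interchange m _ n _ ⟩
    m + n + (∑[ i < m ] ∑[ j < n ] tail i j + ∑[ i < m ] ∑[ j < n ] head i j)
      ≡⟨ cong (m + n +_) (∑∑-distrib-+ tail head) ⟨
    m + n + ∑[ i < m ] ∑[ j < n ] (tail i j + head i j)
      ≡⟨ cong (m + n +_) (sum-cong-≗ (λ i → sum-cong-≗ (charge-split C i))) ⟩
    m + n + ∑[ i < m ] ∑[ j < n ] (b2n (B i j) + backTerm C i j)
      ≡⟨ cong (m + n +_) (∑∑-distrib-+ (λ i j → b2n (B i j)) (backTerm C)) ⟩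
    m + n + (edgeCount + backEdges C)
      ≡⟨ +-assoc (m + n) _ _ ⟨
    m + n + edgeCount + backEdges C ∎
    where
    tail = chargedToTail C
    head = chargedToHead C

  backEdges-sourceCut : backEdges sourceCut ≡ 0
  backEdges-sourceCut = trans (sum-cong-≗ {m} (λ _ → sum-replicate-zero n)) (sum-replicate-zero m)

  backEdges-uvCut : ∀ u v → backEdges (uvCut u v) ≡ b2n (B u v)
  backEdges-uvCut u v = begin
    ∑[ i < m ] ∑[ j < n ] (if not (does (u ≟ i)) then 0 else (if does (v ≟ j) then b2n (B i j) else 0))
      ≡⟨ sum-cong-≗ (λ i → ∑-if-not (does (u ≟ i)) (λ j → if does (v ≟ j) then b2n (B i j) else 0)) ⟩
    ∑[ i < m ] (if does (u ≟ i) then ∑[ j < n ] (if does (v ≟ j) then b2n (B i j) else 0) else 0)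
      ≡⟨ ∑-δ u (λ i → ∑[ j < n ] (if does (v ≟ j) then b2n (B i j) else 0)) ⟩
    ∑[ j < n ] (if does (v ≟ j) then b2n (B u j) else 0)
      ≡⟨ ∑-δ v (λ j → b2n (B u j)) ⟩
    b2n (B u v) ∎
    where
    ∑-if-not : ∀ c (f : Fin n → ℕ) →
               ∑[ j < n ] (if not c then 0 else f j) ≡ (if c then ∑[ j < n ] f j else 0)
    ∑-if-not true  f = refl
    ∑-if-not false f = sum-replicate-zero n

  𝒟-minCut : IsMinCutCapacity (𝒟 B) (m + n + edgeCount)
  𝒟-minCut = (sourceCut , (refl , refl) , capacity-sourceCut)
           , λ C cut → ≤-trans (m≤m+n _ (backEdges C)) (≤-reflexive (sym (capacity-𝒟 C cut)))
    where
    capacity-sourceCut : capacity (𝒟 B) sourceCut ≡ m + n + edgeCount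
    capacity-sourceCut = trans (capacity-𝒟 sourceCut (refl , refl))
                               (trans (cong (m + n + edgeCount +_) backEdges-sourceCut) (+-identityʳ _))

  module _ (u : Fin m) (v : Fin n) where

    capacity-failSU-VT : ∀ C → IsSTCut C →
      capacity (failSU-VT (𝒟 B) u v) C + capacity (failedEdges u v) C ≡ m + n + edgeCount + backEdges C
    capacity-failSU-VT C cut = trans (sym (capacity-+ (𝒟 B) _ _ C 𝒟≡F+Δ)) (capacity-𝒟 C cut)
      where
      𝒟≡F+Δ = failSU-VT+failedEdges (𝒟 B) u v (m≤n+m 1 (outdeg B u)) (m≤n+m 1 (indeg B v))

    capacity-failedEdges≤1+backEdges : B u v ≡ true → ∀ C → IsSTCut C →
                                       capacity (failedEdges u v) C ≤ 1 + backEdges C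
    capacity-failedEdges≤1+backEdges uv∈B C cut =
      ≤-trans (≤-reflexive (capacity-failedEdges u v C cut)) crossings≤
      where
      crossings≤ : (if C (inL u) then 0 else 1) + (if C (inR v) then 1 else 0) ≤ 1 + backEdges C
      crossings≤ with C (inL u) in u∈?C | C (inR v) in v∈?C
      ... | true  | true  = s≤s z≤n
      ... | true  | false = z≤n
      ... | false | false = s≤s z≤n
      ... | false | true  =
        s≤s (subst (λ b → b2n b ≤ backEdges C) uv∈B (backEdge≤backEdges C u v u∈?C v∈?C))

    capacity-failSU-VT-sourceCut : capacity (failSU-VT (𝒟 B) u v) sourceCut + 1 ≡ m + n + edgeCount
    capacity-failSU-VT-sourceCut = begin
      capacity F sourceCut + 1
        ≡⟨ cong (capacity F sourceCut +_) (capacity-failedEdges u v sourceCut (refl , refl)) ⟨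
      capacity F sourceCut + capacity (failedEdges u v) sourceCut
        ≡⟨ capacity-failSU-VT sourceCut (refl , refl) ⟩
      m + n + edgeCount + backEdges sourceCut
        ≡⟨ cong (m + n + edgeCount +_) backEdges-sourceCut ⟩
      m + n + edgeCount + 0
        ≡⟨ +-identityʳ _ ⟩
      m + n + edgeCount ∎
      where
      F = failSU-VT (𝒟 B) u v

    capacity-failSU-VT-uvCut : B u v ≡ false →
                               capacity (failSU-VT (𝒟 B) u v) (uvCut u v) + 2 ≡ m + n + edgeCount
    capacity-failSU-VT-uvCut uv∉B = begin
      capacity F C + 2
        ≡⟨ cong (capacity F C +_) both-failed-edges-cross ⟨
      capacity F C + capacity (failedEdges u v) C
        ≡⟨ capacity-failSU-VT C (refl , refl) ⟩
      m + n + edgeCount + backEdges C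
        ≡⟨ cong (m + n + edgeCount +_) (trans (backEdges-uvCut u v) (cong b2n uv∉B)) ⟩
      m + n + edgeCount + 0
        ≡⟨ +-identityʳ _ ⟩
      m + n + edgeCount ∎
      where
      F = failSU-VT (𝒟 B) u v
      C = uvCut u v
      both-failed-edges-cross : capacity (failedEdges u v) C ≡ 2
      both-failed-edges-cross = trans (capacity-failedEdges u v C (refl , refl))
        (cong₂ (λ u∈C v∈C → (if not u∈C then 0 else 1) + (if v∈C then 1 else 0))
               (dec-true (u ≟ u) refl) (dec-true (v ≟ v) refl))

    capacity-failSU-VT≥ : B u v ≡ true → ∀ C → IsSTCut C →
                          m + n + edgeCount ≤ capacity (failSU-VT (𝒟 B) u v) C + 1
    capacity-failSU-VT≥ uv∈B C cut =
      +-cancelʳ-≤ d N (capacity F C + 1)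
        (≤-trans (+-monoʳ-≤ N (capacity-failedEdges≤1+backEdges uv∈B C cut)) (≤-reflexive (begin
          N + (1 + backEdges C) ≡⟨ x∙yz≈xz∙y N 1 (backEdges C) ⟩
          N + backEdges C + 1   ≡⟨ cong (_+ 1) (capacity-failSU-VT C cut) ⟨
          capacity F C + d + 1  ≡⟨ xy∙z≈xz∙y (capacity F C) d 1 ⟩
          capacity F C + 1 + d  ∎)))
      where
      N = m + n + edgeCount
      F = failSU-VT (𝒟 B) u v
      d = capacity (failedEdges u v) C

    failSU-VT-minCut-edge : B u v ≡ true → ∀ {k′} → IsMinCutCapacity (failSU-VT (𝒟 B) u v) k′ →
                            k′ + 1 ≡ m + n + edgeCount
    failSU-VT-minCut-edge uv∈B ((C , cut , C≡k′) , k′-min) = ≤-antisym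
      (≤-trans (+-monoˡ-≤ 1 (k′-min sourceCut (refl , refl))) (≤-reflexive capacity-failSU-VT-sourceCut))
      (subst (λ c → m + n + edgeCount ≤ c + 1) C≡k′ (capacity-failSU-VT≥ uv∈B C cut))

    failSU-VT-minCut-noEdge : B u v ≡ false → ∀ {k′} → IsMinCutCapacity (failSU-VT (𝒟 B) u v) k′ →
                              k′ + 1 < m + n + edgeCount
    failSU-VT-minCut-noEdge uv∉B {k′} (_ , k′-min) =
      ≤-trans (≤-reflexive (sym (+-suc k′ 1)))
              (≤-trans (+-monoˡ-≤ 2 (k′-min (uvCut u v) (refl , refl)))
                       (≤-reflexive (capacity-failSU-VT-uvCut uv∉B)))

lemma105 : ∀ {m n} (B : BipGraph m n) (u : Fin m) (v : Fin n) (k k′ : ℕ) →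
    IsMinCutCapacity (𝒟 B) k →
    IsMinCutCapacity (failSU-VT (𝒟 B) u v) k′ →
    (k ≡ k′ + 1) ⇔ (B u v ≡ true)
lemma105 {m} {n} B u v k k′ 𝒟-opt F-opt = mk⇔ drop⇒edge edge⇒drop
  where
  k≡N : k ≡ m + n + edgeCount B
  k≡N = minCut-unique 𝒟-opt (𝒟-minCut B)

  edge⇒drop : B u v ≡ true → k ≡ k′ + 1
  edge⇒drop uv∈B = trans k≡N (sym (failSU-VT-minCut-edge B u v uv∈B F-opt))

  drop⇒edge : k ≡ k′ + 1 → B u v ≡ true
  drop⇒edge k≡k′+1 with B u v in uv∈?B
  ... | true  = refl
  ... | false =
    ⊥-elim (<-irrefl (trans (sym k≡k′+1) k≡N) (failSU-VT-minCut-noEdge B u v uv∈?B F-opt))
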